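{- Let $a\in\mathbb{Q}$, $c=-a-a^2$, $f(x)=x^2+c$, and let $p$ be a prime. Then: (1) The following are equivalent: (i) $v_p(a)<0$; (ii) $v_p(f^n(0)-a)<0$ for some $n\ge1$; (iii) $v_p(f^n(0)-a)<0$ for all $n\ge1$. (2) If $v_2(a)=0$, then $v_2(f^n(0)-a)=0$ for all $n\ge 0$. (3) If $v_2(a)\ge1$, then $v_2(f^n(0)-a)=v_2(a)+1$ for all $n\ge2$. (4) If $v_p(a)>0$ and $p\ne2$, then $v_p(f^n(0)-a)=v_p(a)$ for all $n\ge1$. (5) If $v_p(f^m(0)-a)>0$ and $v_p(f^n(0)-a)>0$ for some $m,n\ge1$ with $m\ne n$, then $v_p(a)>0$.
   Context: $v_p$ is the $p$-adic valuation on $\mathbb{Q}$ (with $v_p(0)=\infty$); $f^n$ denotes the $n$-th iterate of $f$, $f^0$ the identity. -}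

module Defs where

open import Data.Nat as ℕ using (ℕ; zero; suc)
open import Data.Nat.DivMod using (_%_; _/_)
open import Data.Integer as ℤ using (ℤ; +_; _-_)
open import Data.Rational as ℚ using (ℚ; ↥_; ↧ₙ_)
open import Relation.Nullary using (yes; no)

-- ℤ extended by ∞ (value of v_p(0))
data ℤ∞ : Set where
  fin : ℤ → ℤ∞
  ∞   : ℤ∞

data _<ᵛ_ : ℤ∞ → ℤ∞ → Set where
  fin<fin : ∀ {i j} → i ℤ.< j → fin i <ᵛ fin j
  fin<∞   : ∀ {i} → fin i <ᵛ ∞

data _≤ᵛ_ : ℤ∞ → ℤ∞ → Set where
  fin≤fin : ∀ {i j} → i ℤ.≤ j → fin i ≤ᵛ fin j
  ≤∞      : ∀ {x} → x ≤ᵛ ∞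

_+ᵛ_ : ℤ∞ → ℤ → ℤ∞
fin i +ᵛ k = fin (i ℤ.+ k)
∞     +ᵛ k = ∞

νgo : ℕ → ℕ → ℕ → ℕ
νgo zero    q n = 0
νgo (suc f) q zero = 0
νgo (suc f) q (suc m) with (suc m) % (2 ℕ.+ q) ℕ.≟ 0
... | yes _ = suc (νgo f q (suc m / (2 ℕ.+ q)))
... | no  _ = 0

-- multiplicity of p in n (n ≠ 0, p ≥ 2); junk value 0 for p < 2 or n = 0
νℕ : ℕ → ℕ → ℕ
νℕ (suc (suc q)) n = νgo n q n
νℕ _ n = 0

val : ℕ → ℚ → ℤ∞
val p x with ↥ x ℤ.≟ + 0
... | yes _ = ∞
... | no  _ = fin (+ νℕ p ℤ.∣ ↥ x ∣ - + νℕ p (↧ₙ x))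

fa : ℚ → ℚ → ℚ
fa a x = x ℚ.* x ℚ.+ (ℚ.- a ℚ.- a ℚ.* a)

orbit : ℚ → ℕ → ℚ
orbit a zero    = ℚ.0ℚ
orbit a (suc n) = fa a (orbit a n)

{-# OPTIONS --safe #-}

-- Write a = N / D in lowest terms. By induction f^n(0) - a = N T n / (D E n), where E 0 = 1,
-- E (n + 1) = D E n², and T n, S n = T n + 2 E n satisfy T 0 = -1, S 0 = 1, S (n + 1) = N T n S n.
-- So v_p(f^n(0) - a) = v_p(N) + v_p(T n) - v_p(D E n), and everything comes down to which T n
-- are divisible by p. If p ∣ D, or p = 2 ∤ N, then p ∣ 2 E (n + 1), so T (n + 1) ≡ N T n S n is
-- never divisible by p. If p ∣ N, p ∤ D and p ≠ 2, then T (n + 1) ≡ -2 E (n + 1) is not either.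
-- If 2 ∣ N and 2 ∤ D, then S (n + 1) is even and T (n + 2) is twice an odd number. Finally, if
-- p ∤ N D, then p ∣ T m forces p ∣ S n for all n > m, which leaves room for at most one T n
-- divisible by p.
module Submission where

open import Defs
open import Data.Integer using (ℤ)
open import Data.Rational using (ℚ)

module Multiplicity where

  open import Data.Nat
  open import Data.Nat.Properties
  open import Data.Nat.DivMod using (_%_; _/_; m/n<m; m*n/n≡m)
  open import Data.Nat.Divisibility using (_∣_; _∤_; _∣?_; divides; _∣0; m%n≡0⇒n∣m; n∣m⇒m%n≡0)
  open import Data.Nat.Primality using (Prime; euclidsLemma; prime⇒nonTrivial)
  open import Data.Nat.Induction using (<-wellFounded)
  open import Induction.WellFounded using (Acc; acc)
  open import Data.Product using (∃₂; _×_; _,_)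
  open import Data.Nat.Tactic.RingSolver using (solve-∀)
  open import Data.Sum using ([_,_]′)
  open import Data.Empty using (⊥-elim)
  open import Relation.Nullary using (yes; no)
  open import Relation.Binary.PropositionalEquality

  private
    νgo-fuel : ∀ q {f g n} → n ≤ f → n ≤ g → νgo f q n ≡ νgo g q n
    νgo-fuel q {zero}  {zero}  z≤n z≤n = refl
    νgo-fuel q {zero}  {suc g} z≤n _   = refl
    νgo-fuel q {suc f} {zero}  _   z≤n = refl
    νgo-fuel q {suc f} {suc g} {zero} _ _ = refl
    νgo-fuel q {suc f} {suc g} {suc m} (s≤s m≤f) (s≤s m≤g) with suc m % (2 + q) ≟ 0
    ... | yes _ = cong suc (νgo-fuel q (≤-trans n/p≤m m≤f) (≤-trans n/p≤m m≤g))
      where n/p≤m = ≤-pred (m/n<m (suc m) (2 + q) (s≤s (s≤s z≤n)))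
    ... | no _  = refl

  νℕ-∤ : ∀ {p n} → p ∤ n → νℕ p n ≡ 0
  νℕ-∤ {zero} _ = refl
  νℕ-∤ {suc zero} _ = refl
  νℕ-∤ {suc (suc q)} {zero} p∤0 = ⊥-elim (p∤0 (_ ∣0))
  νℕ-∤ {suc (suc q)} {suc m} p∤n with suc m % (2 + q) ≟ 0
  ... | yes r≡0 = ⊥-elim (p∤n (m%n≡0⇒n∣m (suc m) (2 + q) r≡0))
  ... | no _    = refl

  private
    νℕ-suc-∣ : ∀ q m → 2 + q ∣ suc m → νℕ (2 + q) (suc m) ≡ suc (νℕ (2 + q) (suc m / (2 + q)))
    νℕ-suc-∣ q m p∣n with suc m % (2 + q) ≟ 0
    ... | yes _ = cong suc (νgo-fuel q n/p≤m ≤-refl)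
      where n/p≤m = ≤-pred (m/n<m (suc m) (2 + q) (s≤s (s≤s z≤n)))
    ... | no r≢0 = ⊥-elim (r≢0 (n∣m⇒m%n≡0 (suc m) (2 + q) p∣n))

  νℕ-p* : ∀ {p m} → 1 < p → m ≢ 0 → νℕ p (p * m) ≡ suc (νℕ p m)
  νℕ-p* {suc (suc q)} {zero} (s≤s (s≤s z≤n)) m≢0 = ⊥-elim (m≢0 refl)
  νℕ-p* {suc (suc q)} {suc k} (s≤s (s≤s z≤n)) _ = begin
    νℕ p (p * suc k)             ≡⟨ νℕ-suc-∣ q (k + suc q * suc k) (divides (suc k) (*-comm p (suc k))) ⟩
    suc (νℕ p (p * suc k / p))   ≡⟨ cong (λ n → suc (νℕ p n)) p*m/p≡m ⟩
    suc (νℕ p (suc k))           ∎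
    where
    open ≡-Reasoning
    p = 2 + q
    p*m/p≡m : p * suc k / p ≡ suc k
    p*m/p≡m = trans (cong (_/ p) (*-comm p (suc k))) (m*n/n≡m (suc k) p)

  private
    ∤⇒≢0 : ∀ {p u} → p ∤ u → u ≢ 0
    ∤⇒≢0 {p} p∤u refl = p∤u (p ∣0)

    p^k*u≢0 : ∀ {p u} k → 1 < p → p ∤ u → p ^ k * u ≢ 0
    p^k*u≢0 {p} k 1<p p∤u eq = [ p^k≢0 , ∤⇒≢0 p∤u ]′ (m*n≡0⇒m≡0∨n≡0 (p ^ k) eq)
      where
      p^k≢0 : p ^ k ≢ 0
      p^k≢0 e = >⇒≢ (<-trans z<s 1<p) (m^n≡0⇒m≡0 p k e)

  ∣⇒νℕ>0 : ∀ {p n} → 1 < p → n ≢ 0 → p ∣ n → 0 < νℕ p n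
  ∣⇒νℕ>0 {p} 1<p n≢0 (divides m refl) =
    subst (0 <_) (sym (trans (cong (νℕ p) (*-comm m p)) (νℕ-p* 1<p m≢0))) z<s
    where
    m≢0 : m ≢ 0
    m≢0 refl = n≢0 refl

  νℕ-p^k* : ∀ {p u} k → 1 < p → p ∤ u → νℕ p (p ^ k * u) ≡ k
  νℕ-p^k* {p} {u} zero _ p∤u = trans (cong (νℕ p) (*-identityˡ u)) (νℕ-∤ p∤u)
  νℕ-p^k* {p} {u} (suc k) 1<p p∤u = begin
    νℕ p (p * p ^ k * u)   ≡⟨ cong (νℕ p) (*-assoc p (p ^ k) u) ⟩
    νℕ p (p * (p ^ k * u)) ≡⟨ νℕ-p* 1<p (p^k*u≢0 k 1<p p∤u) ⟩
    suc (νℕ p (p ^ k * u)) ≡⟨ cong suc (νℕ-p^k* k 1<p p∤u) ⟩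
    suc k                  ∎
    where open ≡-Reasoning

  decompose : ∀ {p} n → 1 < p → n ≢ 0 → ∃₂ λ k u → n ≡ p ^ k * u × p ∤ u
  decompose {p} n 1<p = go n (<-wellFounded n)
    where
    go : ∀ n → Acc _<_ n → n ≢ 0 → ∃₂ λ k u → n ≡ p ^ k * u × p ∤ u
    go n (acc rec) n≢0 with p ∣? n
    ... | no p∤n = 0 , n , sym (*-identityˡ n) , p∤n
    ... | yes (divides m refl) = extend (go m (rec m<m*p) m≢0)
      where
      m≢0 : m ≢ 0
      m≢0 refl = n≢0 refl
      m<m*p : m < m * p
      m<m*p = m<m*n m p {{≢-nonZero m≢0}} 1<p
      extend : (∃₂ λ k u → m ≡ p ^ k * u × p ∤ u) → ∃₂ λ k u → m * p ≡ p ^ k * u × p ∤ u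
      extend (k , u , refl , p∤u) = suc k , u , regroup (p ^ k) u p , p∤u
        where
        regroup : ∀ a b c → a * b * c ≡ c * a * b
        regroup = solve-∀

  prime⇒1<p : ∀ {p} → Prime p → 1 < p
  prime⇒1<p {p} p-prime = nonTrivial⇒n>1 p {{prime⇒nonTrivial p-prime}}

  νℕ-* : ∀ {p m n} → Prime p → m ≢ 0 → n ≢ 0 → νℕ p (m * n) ≡ νℕ p m + νℕ p n
  νℕ-* {p} {m} {n} p-prime m≢0 n≢0 with decompose m (prime⇒1<p p-prime) m≢0 | decompose n (prime⇒1<p p-prime) n≢0
  ... | k , u , refl , p∤u | l , w , refl , p∤w = begin
    νℕ p (p ^ k * u * (p ^ l * w))       ≡⟨ cong (νℕ p) (regroup (p ^ k) u (p ^ l) w) ⟩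
    νℕ p (p ^ k * p ^ l * (u * w))       ≡⟨ cong (λ x → νℕ p (x * (u * w))) (^-distribˡ-+-* p k l) ⟨
    νℕ p (p ^ (k + l) * (u * w))         ≡⟨ νℕ-p^k* (k + l) 1<p p∤uw ⟩
    k + l                                ≡⟨ cong₂ _+_ (νℕ-p^k* k 1<p p∤u) (νℕ-p^k* l 1<p p∤w) ⟨
    νℕ p (p ^ k * u) + νℕ p (p ^ l * w)  ∎
    where
    open ≡-Reasoning
    1<p : 1 < p
    1<p = prime⇒1<p p-prime
    p∤uw : p ∤ u * w
    p∤uw p∣uw = [ p∤u , p∤w ]′ (euclidsLemma u w p-prime p∣uw)
    regroup : ∀ a b c d → a * b * (c * d) ≡ a * c * (b * d)
    regroup = solve-∀

module Fractions where

  open import Data.Integer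
  open import Data.Integer.Properties
  open import Data.Integer.Tactic.RingSolver using (solve-∀)
  open import Data.Rational as ℚ using (ℚ; mkℚ; ↥_; ↧_; toℚᵘ)
  open import Data.Rational.Properties using (toℚᵘ-homo-+; toℚᵘ-homo-*; toℚᵘ-homo‿-)
  open import Data.Rational.Unnormalised as ℚᵘ using (ℚᵘ; mkℚᵘ)
  open import Data.Rational.Unnormalised.Properties using (drop-*≡*)
  open import Data.Sum using ([_,_]′)
  open import Relation.Binary.PropositionalEquality
  open ≡-Reasoning

  infix 4 _≐_÷_

  record _≐_÷_ (x : ℚ) (P Q : ℤ) : Set where
    constructor fraction
    field
      cross : ↥ x * Q ≡ P * ↧ x
      den≢0 : Q ≢ 0ℤ

  open _≐_÷_ public

  *≢0 : ∀ {i j} → i ≢ 0ℤ → j ≢ 0ℤ → i * j ≢ 0ℤ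
  *≢0 {i} i≢0 j≢0 ij≡0 = [ i≢0 , j≢0 ]′ (i*j≡0⇒i≡0∨j≡0 i ij≡0)

  private
    swap₂₃ : ∀ i j k → i * j * k ≡ i * k * j
    swap₂₃ = solve-∀

    from-≃ᵘ : ∀ {x P Q} {u : ℚᵘ} → toℚᵘ x ℚᵘ.≃ u →
              ℚᵘ.↥ u * Q ≡ P * ℚᵘ.↧ u → Q ≢ 0ℤ → x ≐ P ÷ Q
    from-≃ᵘ {x@(mkℚ X _ _)} {P} {Q} {mkℚᵘ U e} x≃u u≡P/Q Q≢0 = fraction (*-cancelʳ-≡ _ _ ↧u (begin
      X * Q * ↧u    ≡⟨ swap₂₃ X Q ↧u ⟩
      X * ↧u * Q    ≡⟨ cong (_* Q) (drop-*≡* x≃u) ⟩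
      U * ↧ x * Q   ≡⟨ swap₂₃ U (↧ x) Q ⟩
      U * Q * ↧ x   ≡⟨ cong (_* ↧ x) u≡P/Q ⟩
      P * ↧u * ↧ x  ≡⟨ swap₂₃ P ↧u (↧ x) ⟩
      P * ↧ x * ↧u  ∎)) Q≢0
      where ↧u = +[1+ e ]

  ≐-self : ∀ x → x ≐ ↥ x ÷ ↧ x
  ≐-self x = fraction refl (λ ())

  ≐-+ : ∀ {x y P Q R S} → x ≐ P ÷ Q → y ≐ R ÷ S → x ℚ.+ y ≐ P * S + R * Q ÷ (Q * S)
  ≐-+ {x@(mkℚ X _ _)} {y@(mkℚ Y _ _)} {P} {Q} {R} {S} (fraction x≡P/Q Q≢0) (fraction y≡R/S S≢0) =
    from-≃ᵘ (toℚᵘ-homo-+ x y) (begin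
      (X * dy + Y * dx) * (Q * S)               ≡⟨ regroup X Y dx dy Q S ⟩
      (X * Q) * (dy * S) + (Y * S) * (dx * Q)   ≡⟨ cong₂ (λ u v → u * (dy * S) + v * (dx * Q)) x≡P/Q y≡R/S ⟩
      (P * dx) * (dy * S) + (R * dy) * (dx * Q) ≡⟨ collect P R dx dy Q S ⟩
      (P * S + R * Q) * (dx * dy)               ∎) (*≢0 Q≢0 S≢0)
    where
    dx dy : ℤ
    dx = ↧ x
    dy = ↧ y
    regroup : ∀ X Y dx dy Q S → (X * dy + Y * dx) * (Q * S) ≡ (X * Q) * (dy * S) + (Y * S) * (dx * Q)
    regroup = solve-∀
    collect : ∀ P R dx dy Q S → (P * dx) * (dy * S) + (R * dy) * (dx * Q) ≡ (P * S + R * Q) * (dx * dy)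
    collect = solve-∀

  ≐-* : ∀ {x y P Q R S} → x ≐ P ÷ Q → y ≐ R ÷ S → x ℚ.* y ≐ P * R ÷ (Q * S)
  ≐-* {x@(mkℚ X _ _)} {y@(mkℚ Y _ _)} {P} {Q} {R} {S} (fraction x≡P/Q Q≢0) (fraction y≡R/S S≢0) =
    from-≃ᵘ (toℚᵘ-homo-* x y) (begin
      (X * Y) * (Q * S)      ≡⟨ interchange X Y Q S ⟩
      (X * Q) * (Y * S)      ≡⟨ cong₂ _*_ x≡P/Q y≡R/S ⟩
      (P * ↧ x) * (R * ↧ y)  ≡⟨ interchange P (↧ x) R (↧ y) ⟩
      (P * R) * (↧ x * ↧ y)  ∎) (*≢0 Q≢0 S≢0)
    where
    interchange : ∀ a b c d → (a * b) * (c * d) ≡ (a * c) * (b * d)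
    interchange = solve-∀

  ≐-neg : ∀ {x P Q} → x ≐ P ÷ Q → ℚ.- x ≐ - P ÷ Q
  ≐-neg {x@(mkℚ X _ _)} {P} {Q} (fraction x≡P/Q Q≢0) =
    from-≃ᵘ (toℚᵘ-homo‿- x) (begin
      - X * Q      ≡⟨ neg-distribˡ-* X Q ⟨
      - (X * Q)    ≡⟨ cong -_ x≡P/Q ⟩
      - (P * ↧ x)  ≡⟨ neg-distribˡ-* P (↧ x) ⟩
      - P * ↧ x    ∎) Q≢0

  ≐-rescale : ∀ {x P Q P′ Q′} → x ≐ P ÷ Q → P * Q′ ≡ P′ * Q → Q′ ≢ 0ℤ → x ≐ P′ ÷ Q′
  ≐-rescale {x} {P} {Q} {P′} {Q′} (fraction x≡P/Q Q≢0) PQ′≡P′Q Q′≢0 =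
    fraction (*-cancelʳ-≡ _ _ Q {{≢-nonZero Q≢0}} (begin
      ↥ x * Q′ * Q   ≡⟨ swap₂₃ (↥ x) Q′ Q ⟩
      ↥ x * Q * Q′   ≡⟨ cong (_* Q′) x≡P/Q ⟩
      P * ↧ x * Q′   ≡⟨ swap₂₃ P (↧ x) Q′ ⟩
      P * Q′ * ↧ x   ≡⟨ cong (_* ↧ x) PQ′≡P′Q ⟩
      P′ * Q * ↧ x   ≡⟨ swap₂₃ P′ Q (↧ x) ⟩
      P′ * ↧ x * Q   ∎)) Q′≢0

module Valuation where

  open Multiplicity
  open Fractions
  open import Data.Nat as ℕ using (ℕ; s≤s; z≤n)
  open import Data.Nat.Base using (nonTrivial⇒≢1)
  open import Data.Nat.Divisibility using (∣1⇒≡1) renaming (_∣_ to _ℕ∣_)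
  open import Data.Nat.Coprimality using (recompute)
  open import Data.Nat.Primality using (Prime; euclidsLemma; prime⇒nonTrivial; prime⇒irreducible; prime[2])
  open import Data.Sum as Sum using (_⊎_; inj₁; inj₂; [_,_]′)
  open import Data.Integer
  open import Data.Integer.Properties
  open import Data.Integer.Divisibility.Signed using (_∣_; divides; ∣ᵤ⇒∣; ∣⇒∣ᵤ; _∣?_)
  open import Function.Base using (case_of_)
  open import Data.Integer.Tactic.RingSolver using (solve-∀)
  open import Data.Rational as ℚ using (mkℚ; ↥_; ↧_)
  open import Data.Product using (_×_; _,_)
  open import Data.Empty using (⊥-elim)
  open import Function.Bundles using (_⇔_; mk⇔)
  open import Relation.Nullary using (¬_; yes; no)
  open import Relation.Binary.PropositionalEquality
  open ≡-Reasoning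

  infix 4 _∣ℤ_

  _∣ℤ_ : ℕ → ℤ → Set
  p ∣ℤ i = + p ∣ i

  νℤ : ℕ → ℤ → ℕ
  νℤ p i = νℕ p ∣ i ∣

  private
    ∣∣≢0 : ∀ {i} → i ≢ 0ℤ → ∣ i ∣ ≢ 0
    ∣∣≢0 i≢0 ∣i∣≡0 = i≢0 (∣i∣≡0⇒i≡0 ∣i∣≡0)

    ∣⇒ν>0 : ∀ {p i} → Prime p → i ≢ 0ℤ → p ∣ℤ i → 0 ℕ.< νℤ p i
    ∣⇒ν>0 p-prime i≢0 p∣i = ∣⇒νℕ>0 (prime⇒1<p p-prime) (∣∣≢0 i≢0) (∣⇒∣ᵤ p∣i)

    difference-cong : ∀ a b c d → a ℕ.+ b ≡ c ℕ.+ d → + a - + d ≡ + c - + b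
    difference-cong a b c d a+b≡c+d = begin
      + a - + d                  ≡⟨ add-both (+ a) (+ b) (+ d) ⟩
      (+ a + + b) - (+ b + + d)  ≡⟨ cong (_- (+ b + + d)) +a++b≡+c++d ⟩
      (+ c + + d) - (+ b + + d)  ≡⟨ cancel-both (+ c) (+ d) (+ b) ⟩
      + c - + b                  ∎
      where
      +a++b≡+c++d : + a + + b ≡ + c + + d
      +a++b≡+c++d = trans (sym (pos-+ a b)) (trans (cong +_ a+b≡c+d) (pos-+ c d))
      add-both : ∀ a b d → a - d ≡ (a + b) - (b + d)
      add-both = solve-∀
      cancel-both : ∀ c d b → (c + d) - (b + d) ≡ c - b
      cancel-both = solve-∀

  ∤⇒≢0 : ∀ {p i} → ¬ p ∣ℤ i → i ≢ 0ℤ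
  ∤⇒≢0 p∤0 refl = p∤0 (divides 0ℤ refl)

  νℤ-∤ : ∀ {p i} → ¬ p ∣ℤ i → νℤ p i ≡ 0
  νℤ-∤ p∤i = νℕ-∤ (λ p∣∣i∣ → p∤i (∣ᵤ⇒∣ p∣∣i∣))

  νℤ-* : ∀ {p i j} → Prime p → i ≢ 0ℤ → j ≢ 0ℤ → νℤ p (i * j) ≡ νℤ p i ℕ.+ νℤ p j
  νℤ-* {p} {i} {j} p-prime i≢0 j≢0 =
    trans (cong (νℕ p) (abs-* i j)) (νℕ-* p-prime (∣∣≢0 i≢0) (∣∣≢0 j≢0))

  νℤ-p* : ∀ {p i} → Prime p → i ≢ 0ℤ → νℤ p (+ p * i) ≡ ℕ.suc (νℤ p i)
  νℤ-p* {p} {i} p-prime i≢0 = trans (cong (νℕ p) (abs-* (+ p) i)) (νℕ-p* (prime⇒1<p p-prime) (∣∣≢0 i≢0))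

  euclidsLemmaℤ : ∀ {p} i j → Prime p → p ∣ℤ i * j → p ∣ℤ i ⊎ p ∣ℤ j
  euclidsLemmaℤ {p} i j p-prime p∣ij =
    Sum.map ∣ᵤ⇒∣ ∣ᵤ⇒∣
      (euclidsLemma ∣ i ∣ ∣ j ∣ p-prime (subst (p ℕ∣_) (abs-* i j) (∣⇒∣ᵤ p∣ij)))

  ∤-* : ∀ {p i j} → Prime p → ¬ p ∣ℤ i → ¬ p ∣ℤ j → ¬ p ∣ℤ i * j
  ∤-* {i = i} {j} p-prime p∤i p∤j p∣ij = [ p∤i , p∤j ]′ (euclidsLemmaℤ i j p-prime p∣ij)

  ∤-unit : ∀ {p i} → Prime p → ∣ i ∣ ≡ 1 → ¬ p ∣ℤ i
  ∤-unit {p} p-prime ∣i∣≡1 p∣i =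
    nonTrivial⇒≢1 {{prime⇒nonTrivial p-prime}} (∣1⇒≡1 (subst (p ℕ∣_) ∣i∣≡1 (∣⇒∣ᵤ p∣i)))

  ∣2⇒≡2 : ∀ {p} → Prime p → p ∣ℤ + 2 → p ≡ 2
  ∣2⇒≡2 p-prime p∣2 with prime⇒irreducible prime[2] (∣⇒∣ᵤ p∣2)
  ... | inj₁ p≡1 = ⊥-elim (nonTrivial⇒≢1 {{prime⇒nonTrivial p-prime}} p≡1)
  ... | inj₂ p≡2 = p≡2

  ∣↥⇒∤↧ : ∀ {p} x → Prime p → p ∣ℤ ↥ x → ¬ p ∣ℤ ↧ x
  ∣↥⇒∤↧ (mkℚ _ _ coprime) p-prime p∣↥x p∣↧x =
    nonTrivial⇒≢1 {{prime⇒nonTrivial p-prime}} (recompute coprime (∣⇒∣ᵤ p∣↥x , ∣⇒∣ᵤ p∣↧x))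

  val-÷ : ∀ {p x P Q} → Prime p → x ≐ P ÷ Q → P ≢ 0ℤ → val p x ≡ fin (+ νℤ p P - + νℤ p Q)
  val-÷ {p} {x} {P} {Q} p-prime (fraction x≡P/Q Q≢0) P≢0 with ↥ x ≟ 0ℤ
  ... | yes ↥x≡0 = ⊥-elim (P≢0 (*-cancelʳ-≡ P 0ℤ (↧ x) (begin
    P * ↧ x  ≡⟨ x≡P/Q ⟨
    ↥ x * Q  ≡⟨ cong (_* Q) ↥x≡0 ⟩
    0ℤ       ∎)))
  ... | no ↥x≢0 = cong fin (difference-cong (νℤ p (↥ x)) (νℤ p Q) (νℤ p P) (νℤ p (↧ x)) (begin
    νℤ p (↥ x) ℕ.+ νℤ p Q   ≡⟨ νℤ-* p-prime ↥x≢0 Q≢0 ⟨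
    νℤ p (↥ x * Q)          ≡⟨ cong (νℤ p) x≡P/Q ⟩
    νℤ p (P * ↧ x)          ≡⟨ νℤ-* p-prime P≢0 (λ ()) ⟩
    νℤ p P ℕ.+ νℤ p (↧ x)   ∎))

  val-÷0 : ∀ {p x P Q} → x ≐ P ÷ Q → P ≡ 0ℤ → val p x ≡ ∞
  val-÷0 {p} {x} {Q = Q} (fraction x≡P/Q Q≢0) refl with ↥ x ≟ 0ℤ
  ... | yes _ = refl
  ... | no ↥x≢0 = ⊥-elim (↥x≢0 (*-cancelʳ-≡ (↥ x) 0ℤ Q {{≢-nonZero Q≢0}} x≡P/Q))

  val-÷-∤den : ∀ {p x P Q} → Prime p → x ≐ P ÷ Q → P ≢ 0ℤ → ¬ p ∣ℤ Q → val p x ≡ fin (+ νℤ p P)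
  val-÷-∤den {p} {x} {P} {Q} p-prime x≐P/Q P≢0 p∤Q = begin
    val p x                     ≡⟨ val-÷ p-prime x≐P/Q P≢0 ⟩
    fin (+ νℤ p P - + νℤ p Q)   ≡⟨ cong (λ k → fin (+ νℤ p P - + k)) (νℤ-∤ p∤Q) ⟩
    fin (+ νℤ p P + 0ℤ)         ≡⟨ cong fin (+-identityʳ _) ⟩
    fin (+ νℤ p P)              ∎

  val-÷≡0 : ∀ {p x P Q} → Prime p → x ≐ P ÷ Q → ¬ p ∣ℤ P → ¬ p ∣ℤ Q → val p x ≡ fin 0ℤ
  val-÷≡0 p-prime x≐P/Q p∤P p∤Q =
    trans (val-÷-∤den p-prime x≐P/Q (∤⇒≢0 p∤P) p∤Q) (cong (λ k → fin (+ k)) (νℤ-∤ p∤P))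

  val-÷>0 : ∀ {p x P Q} → Prime p → x ≐ P ÷ Q → p ∣ℤ P → ¬ p ∣ℤ Q → fin 0ℤ <ᵛ val p x
  val-÷>0 {P = P} p-prime x≐P/Q p∣P p∤Q with P ≟ 0ℤ
  ... | yes refl = subst (fin 0ℤ <ᵛ_) (sym (val-÷0 x≐P/Q refl)) fin<∞
  ... | no P≢0   = subst (fin 0ℤ <ᵛ_) (sym (val-÷-∤den p-prime x≐P/Q P≢0 p∤Q))
                     (fin<fin (+<+ (∣⇒ν>0 p-prime P≢0 p∣P)))

  val-÷>0⇒∣ : ∀ {p x P Q} → Prime p → x ≐ P ÷ Q → ¬ p ∣ℤ Q → fin 0ℤ <ᵛ val p x → p ∣ℤ P
  val-÷>0⇒∣ {p} {P = P} p-prime x≐P/Q p∤Q 0<v with + p ∣? P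
  ... | yes p∣P = p∣P
  ... | no p∤P  = case subst (fin 0ℤ <ᵛ_) (val-÷≡0 p-prime x≐P/Q p∤P p∤Q) 0<v of λ { (fin<fin (+<+ ())) }

  val-÷<0⇔ : ∀ {p x P Q} → Prime p → x ≐ P ÷ Q → ¬ (p ∣ℤ P × p ∣ℤ Q) →
             (val p x <ᵛ fin 0ℤ ⇔ p ∣ℤ Q)
  val-÷<0⇔ {p} {x} {P} {Q} p-prime x≐P/Q not-both = mk⇔ to from
    where
    ≮0 : ¬ p ∣ℤ Q → ¬ val p x <ᵛ fin 0ℤ
    ≮0 p∤Q with P ≟ 0ℤ
    ... | yes refl = λ v<0 → case subst (_<ᵛ fin 0ℤ) (val-÷0 x≐P/Q refl) v<0 of λ ()
    ... | no P≢0   = λ v<0 →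
      case subst (_<ᵛ fin 0ℤ) (val-÷-∤den p-prime x≐P/Q P≢0 p∤Q) v<0 of λ { (fin<fin (+<+ ())) }
    to : val p x <ᵛ fin 0ℤ → p ∣ℤ Q
    to v<0 with + p ∣? Q
    ... | yes p∣Q = p∣Q
    ... | no p∤Q  = ⊥-elim (≮0 p∤Q v<0)
    from : p ∣ℤ Q → val p x <ᵛ fin 0ℤ
    from p∣Q = subst (_<ᵛ fin 0ℤ) (sym (val-÷ p-prime x≐P/Q (∤⇒≢0 p∤P)))
                 (subst (λ k → fin (+ k - + νℤ p Q) <ᵛ fin 0ℤ) (sym (νℤ-∤ p∤P))
                   (fin<fin (0-n<0 (∣⇒ν>0 p-prime (den≢0 x≐P/Q) p∣Q))))
      where
      p∤P : ¬ p ∣ℤ P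
      p∤P p∣P = not-both (p∣P , p∣Q)
      0-n<0 : ∀ {n} → 0 ℕ.< n → + 0 - + n < 0ℤ
      0-n<0 (s≤s z≤n) = -<+

module ExtendedOrder where

  open import Data.Integer using (+_; 0ℤ; +<+)
  open import Data.Integer.Properties using (<-irrefl; <-asym; <-≤-trans; +-identityʳ)
  open import Data.Nat using (s≤s; z≤n)
  open import Relation.Nullary using (¬_)
  open import Relation.Binary.PropositionalEquality using (_≡_; refl; cong)

  <ᵛ-irrefl : ∀ {x} → ¬ x <ᵛ x
  <ᵛ-irrefl (fin<fin i<i) = <-irrefl refl i<i

  <ᵛ-asym : ∀ {x y} → x <ᵛ y → ¬ y <ᵛ x
  <ᵛ-asym (fin<fin i<j) (fin<fin j<i) = <-asym i<j j<i

  1≤ᵛ⇒0<ᵛ : ∀ {x} → fin (+ 1) ≤ᵛ x → fin 0ℤ <ᵛ x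
  1≤ᵛ⇒0<ᵛ (fin≤fin 1≤i) = fin<fin (<-≤-trans (+<+ (s≤s z≤n)) 1≤i)
  1≤ᵛ⇒0<ᵛ ≤∞            = fin<∞

  +ᵛ-identityʳ : ∀ x → x +ᵛ 0ℤ ≡ x
  +ᵛ-identityʳ (fin i) = cong fin (+-identityʳ i)
  +ᵛ-identityʳ ∞       = refl

-- With a = N / D: f^n(0) = N R n / (D E n) and f^n(0) - a = N T n / (D E n).
module OrbitSequences (N D : ℤ) where

  open Fractions
  open Valuation
  open import Data.Nat as ℕ using (ℕ; zero; suc; _<_)
  open import Data.Nat.Properties using (<-cmp; m<1+n⇒m<n∨m≡n)
  open import Data.Nat.Primality using (Prime; prime[2])
  open import Data.Integer hiding (suc; _<_)
  open import Data.Integer.Divisibility.Signed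
    using (divides; ∣m∣n⇒∣m+n; ∣m∣n⇒∣m-n; ∣m+n∣m⇒∣n; ∣m⇒∣m*n; ∣n⇒∣m*n)
  open import Data.Integer.Tactic.RingSolver using (solve-∀)
  open import Data.Rational as ℚ using (ℚ)
  open import Data.Product using (_×_; _,_; proj₁; ∃-syntax)
  open import Data.Sum using (_⊎_; inj₁; [_,_]′)
  open import Function.Base using (id; _∘_)
  open import Data.Empty using (⊥-elim)
  open import Relation.Nullary using (¬_)
  open import Relation.Binary.Definitions using (tri<; tri≈; tri>)
  open import Relation.Binary.PropositionalEquality
  open ≡-Reasoning

  E : ℕ → ℤ
  E zero    = 1ℤ
  E (suc n) = D * E n * E n

  R : ℕ → ℤ
  R zero    = 0ℤ
  R (suc n) = N * R n * R n - (D + N) * E n * E n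

  T : ℕ → ℤ
  T n = R n - E n

  S : ℕ → ℤ
  S n = R n + E n

  S-suc : ∀ n → S (suc n) ≡ N * T n * S n
  S-suc n = identity N D (R n) (E n)
    where
    identity : ∀ N D r e → (N * r * r - (D + N) * e * e) + D * e * e ≡ N * (r - e) * (r + e)
    identity = solve-∀

  T-suc : ∀ n → T (suc n) ≡ N * T n * S n - + 2 * E (suc n)
  T-suc n = identity N D (R n) (E n)
    where
    identity : ∀ N D r e → (N * r * r - (D + N) * e * e) - D * e * e ≡ N * (r - e) * (r + e) - + 2 * (D * e * e)
    identity = solve-∀

  S≡T+2E : ∀ n → S n ≡ T n + + 2 * E n
  S≡T+2E n = identity (R n) (E n)
    where
    identity : ∀ r e → r + e ≡ (r - e) + + 2 * e
    identity = solve-∀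

  ∣N⇒∣S : ∀ {p} → p ∣ℤ N → ∀ n → p ∣ℤ S (suc n)
  ∣N⇒∣S p∣N n = subst (_ ∣ℤ_) (sym (S-suc n)) (∣m⇒∣m*n (S n) (∣m⇒∣m*n (T n) p∣N))

  module _ {a : ℚ} (a≐N/D : a ≐ N ÷ D) where

    E≢0 : ∀ n → E n ≢ 0ℤ
    E≢0 zero    ()
    E≢0 (suc n) = *≢0 (*≢0 (den≢0 a≐N/D) (E≢0 n)) (E≢0 n)

    DE≢0 : ∀ n → D * E n ≢ 0ℤ
    DE≢0 n = *≢0 (den≢0 a≐N/D) (E≢0 n)

    orbit-÷ : ∀ n → orbit a n ≐ N * R n ÷ (D * E n)
    orbit-÷ zero = ≐-rescale (≐-self ℚ.0ℚ) (identity N D) (DE≢0 0)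
      where
      identity : ∀ N D → 0ℤ * (D * 1ℤ) ≡ N * 0ℤ * 1ℤ
      identity = solve-∀
    orbit-÷ (suc n) = ≐-rescale (≐-+ (≐-* y≐ y≐) (≐-+ (≐-neg a≐N/D) (≐-neg (≐-* a≐N/D a≐N/D))))
                        (identity N D (R n) (E n)) (DE≢0 (suc n))
      where
      y≐ : orbit a n ≐ N * R n ÷ (D * E n)
      y≐ = orbit-÷ n
      identity : ∀ N D R E →
        ((N * R) * (N * R) * (D * (D * D)) + ((- N) * (D * D) + (- (N * N)) * D) * ((D * E) * (D * E))) * (D * (D * E * E))
          ≡ (N * (N * R * R - (D + N) * E * E)) * ((D * E) * (D * E) * (D * (D * D)))
      identity = solve-∀

    orbit-a-÷ : ∀ n → orbit a n ℚ.- a ≐ N * T n ÷ (D * E n)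
    orbit-a-÷ n = ≐-rescale (≐-+ (orbit-÷ n) (≐-neg a≐N/D)) (identity N D (R n) (E n)) (DE≢0 n)
      where
      identity : ∀ N D R E → (N * R * D + (- N) * (D * E)) * (D * E) ≡ N * (R - E) * (D * E * D)
      identity = solve-∀

  module _ {p} (p-prime : Prime p) where

    ∣E⇒∣D : ∀ n → p ∣ℤ E n → p ∣ℤ D
    ∣E⇒∣D zero    p∣1 = ⊥-elim (∤-unit p-prime refl p∣1)
    ∣E⇒∣D (suc n) p∣E = [ [ id , ∣E⇒∣D n ]′ ∘ euclidsLemmaℤ D (E n) p-prime , ∣E⇒∣D n ]′
                          (euclidsLemmaℤ (D * E n) (E n) p-prime p∣E)

    ∣DE⇒∣D : ∀ n → p ∣ℤ D * E n → p ∣ℤ D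
    ∣DE⇒∣D n p∣DE = [ id , ∣E⇒∣D n ]′ (euclidsLemmaℤ D (E n) p-prime p∣DE)

    ∤D⇒∤DE : ¬ p ∣ℤ D → ∀ n → ¬ p ∣ℤ D * E n
    ∤D⇒∤DE p∤D n = p∤D ∘ ∣DE⇒∣D n

    ∣D⇒∣E : p ∣ℤ D → ∀ n → p ∣ℤ E (suc n)
    ∣D⇒∣E p∣D n = ∣m⇒∣m*n (E n) (∣m⇒∣m*n (E n) p∣D)

    ∣S∣T⇒∣2 : ¬ p ∣ℤ D → ∀ n → p ∣ℤ S n → p ∣ℤ T n → p ∣ℤ + 2
    ∣S∣T⇒∣2 p∤D n p∣S p∣T = [ id , (λ p∣E → ⊥-elim (p∤D (∣E⇒∣D n p∣E))) ]′
      (euclidsLemmaℤ (+ 2) (E n) p-prime (∣m+n∣m⇒∣n (subst (p ∣ℤ_) (S≡T+2E n) p∣S) p∣T))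

    -- Either alternative makes p divide 2 E (n + 1), so T (n + 1) ≡ S (n + 1) = N T n S n modulo p.
    TS-∤ : ¬ p ∣ℤ N → p ∣ℤ + 2 ⊎ p ∣ℤ D → ∀ n → ¬ p ∣ℤ T n × ¬ p ∣ℤ S n
    TS-∤ p∤N p∣2⊎p∣D zero    = ∤-unit p-prime refl , ∤-unit p-prime refl
    TS-∤ p∤N p∣2⊎p∣D (suc n) with TS-∤ p∤N p∣2⊎p∣D n
    ... | p∤T , p∤S = p∤T′ , p∤S′
      where
      p∤S′ : ¬ p ∣ℤ S (suc n)
      p∤S′ p∣S′ = ∤-* p-prime (∤-* p-prime p∤N p∤T) p∤S (subst (p ∣ℤ_) (S-suc n) p∣S′)
      p∣2E′ : p ∣ℤ + 2 * E (suc n)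
      p∣2E′ = [ ∣m⇒∣m*n (E (suc n)) , (λ p∣D → ∣n⇒∣m*n (+ 2) (∣D⇒∣E p∣D n)) ]′ p∣2⊎p∣D
      p∤T′ : ¬ p ∣ℤ T (suc n)
      p∤T′ p∣T′ = p∤S′ (subst (p ∣ℤ_) (sym (S≡T+2E (suc n))) (∣m∣n⇒∣m+n p∣T′ p∣2E′))

    T-∤ : p ∣ℤ N → ¬ p ∣ℤ + 2 → ¬ p ∣ℤ D → ∀ n → ¬ p ∣ℤ T (suc n)
    T-∤ p∣N p∤2 p∤D n p∣T = p∤2 (∣S∣T⇒∣2 p∤D (suc n) (∣N⇒∣S p∣N n) p∣T)

    ∣T⇒∣S : ∀ {m n} → p ∣ℤ T m → m < n → p ∣ℤ S n
    ∣T⇒∣S {m} {suc n} p∣Tm m<1+n = subst (p ∣ℤ_) (sym (S-suc n)) ([ earlier , at ]′ (m<1+n⇒m<n∨m≡n m<1+n))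
      where
      earlier : m < n → p ∣ℤ N * T n * S n
      earlier m<n = ∣n⇒∣m*n (N * T n) (∣T⇒∣S p∣Tm m<n)
      at : m ≡ n → p ∣ℤ N * T n * S n
      at refl = ∣m⇒∣m*n (S n) (∣n⇒∣m*n N p∣Tm)

    private
      not-twice : ¬ p ∣ℤ N → ¬ p ∣ℤ D → ∀ {m n} → p ∣ℤ T m → p ∣ℤ T n → ¬ m < n
      not-twice p∤N p∤D {n = n} p∣Tm p∣Tn m<n =
        proj₁ (TS-∤ p∤N (inj₁ (∣S∣T⇒∣2 p∤D n (∣T⇒∣S p∣Tm m<n) p∣Tn)) n) p∣Tn

    -- If p ∣ T m and p ∣ T n with m < n, then p divides S n and T n, hence 2 E n, so p = 2;
    -- but for p = 2 no T n is even.
    ∣T-unique : ¬ p ∣ℤ N → ¬ p ∣ℤ D → ∀ {m n} → p ∣ℤ T m → p ∣ℤ T n → m ≡ n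
    ∣T-unique p∤N p∤D {m} {n} p∣Tm p∣Tn with <-cmp m n
    ... | tri< m<n _ _ = ⊥-elim (not-twice p∤N p∤D p∣Tm p∣Tn m<n)
    ... | tri≈ _ m≡n _ = m≡n
    ... | tri> _ _ n<m = ⊥-elim (not-twice p∤N p∤D p∣Tn p∣Tm n<m)

  T-2-adic : 2 ∣ℤ N → ¬ 2 ∣ℤ D → ∀ n → ∃[ W ] T (suc (suc n)) ≡ + 2 * W × ¬ 2 ∣ℤ W
  T-2-adic 2∣N@(divides N′ N≡N′*2) 2∤D n = W , T≡2W , 2∤W
    where
    T′ S′ E″ W : ℤ
    T′ = T (suc n)
    S′ = S (suc n)
    E″ = E (suc (suc n))
    W = N′ * T′ * S′ - E″
    T≡2W : T (suc (suc n)) ≡ + 2 * W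
    T≡2W = begin
      T (suc (suc n))             ≡⟨ T-suc (suc n) ⟩
      N * T′ * S′ - + 2 * E″      ≡⟨ cong (λ z → z * T′ * S′ - + 2 * E″) N≡N′*2 ⟩
      N′ * + 2 * T′ * S′ - + 2 * E″ ≡⟨ factor N′ T′ S′ E″ ⟩
      + 2 * W                     ∎
      where
      factor : ∀ N′ T′ S′ E″ → N′ * + 2 * T′ * S′ - + 2 * E″ ≡ + 2 * (N′ * T′ * S′ - E″)
      factor = solve-∀
    2∣N′T′S′ : 2 ∣ℤ N′ * T′ * S′
    2∣N′T′S′ = ∣n⇒∣m*n (N′ * T′) (∣N⇒∣S 2∣N n)
    2∤W : ¬ 2 ∣ℤ W
    2∤W 2∣W = 2∤D (∣E⇒∣D prime[2] (suc (suc n)) 2∣E″)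
      where
      cancel : ∀ x y → x - (x - y) ≡ y
      cancel = solve-∀
      2∣E″ : 2 ∣ℤ E″
      2∣E″ = subst (2 ∣ℤ_) (cancel (N′ * T′ * S′) E″) (∣m∣n⇒∣m-n 2∣N′T′S′ 2∣W)

module OrbitValuation (a : ℚ) where

  open Fractions using (_≐_÷_; ≐-self; *≢0)
  open Valuation
  open ExtendedOrder
  open import Data.Nat as ℕ using (suc; _≤_; s≤s)
  open import Data.Nat.Primality using (Prime; prime[2])
  open import Data.Integer hiding (suc; _≤_)
  open import Data.Integer.Properties using (pos-+)
  open import Data.Integer.Divisibility.Signed using (_∣?_; ∣-refl; ∣m⇒∣m*n)
  open import Data.Rational as ℚ using (↥_; ↧_)
  open import Data.Product using (_×_; _,_; proj₁; ∃-syntax)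
  open import Data.Sum using (inj₁; inj₂; [_,_]′)
  open import Data.Empty using (⊥-elim)
  open import Function.Base using (id; _∘_)
  open import Function.Bundles using (_⇔_; mk⇔; Equivalence)
  open import Function.Properties.Equivalence using () renaming (trans to ⇔-trans; sym to ⇔-sym)
  open import Relation.Nullary using (¬_; Dec; yes; no)
  open import Relation.Binary.PropositionalEquality
  open ≡-Reasoning

  private
    N D : ℤ
    N = ↥ a
    D = ↧ a

  open OrbitSequences N D

  private
    a≐N/D : a ≐ N ÷ D
    a≐N/D = ≐-self a

    orbit≐ : ∀ n → orbit a n ℚ.- a ≐ N * T n ÷ (D * E n)
    orbit≐ = orbit-a-÷ a≐N/D

  val<0⇔∣D : ∀ {p} → Prime p → val p a <ᵛ fin 0ℤ ⇔ p ∣ℤ D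
  val<0⇔∣D p-prime = val-÷<0⇔ p-prime a≐N/D (λ (p∣N , p∣D) → ∣↥⇒∤↧ a p-prime p∣N p∣D)

  val-orbit<0⇔∣D : ∀ {p} → Prime p → ∀ n → val p (orbit a n ℚ.- a) <ᵛ fin 0ℤ ⇔ p ∣ℤ D
  val-orbit<0⇔∣D {p} p-prime n =
    ⇔-trans (val-÷<0⇔ p-prime (orbit≐ n) not-both) (mk⇔ (∣DE⇒∣D p-prime n) (∣m⇒∣m*n (E n)))
    where
    not-both : ¬ (p ∣ℤ N * T n × p ∣ℤ D * E n)
    not-both (p∣NT , p∣DE) = ∤-* p-prime p∤N (proj₁ (TS-∤ p-prime p∤N (inj₂ p∣D) n)) p∣NT
      where
      p∣D : p ∣ℤ D
      p∣D = ∣DE⇒∣D p-prime n p∣DE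
      p∤N : ¬ p ∣ℤ N
      p∤N p∣N = ∣↥⇒∤↧ a p-prime p∣N p∣D

  val<0⇔val-orbit<0 : ∀ {p} → Prime p → ∀ n → val p a <ᵛ fin 0ℤ ⇔ val p (orbit a n ℚ.- a) <ᵛ fin 0ℤ
  val<0⇔val-orbit<0 p-prime n = ⇔-trans (val<0⇔∣D p-prime) (⇔-sym (val-orbit<0⇔∣D p-prime n))

  0<val⇒∤D : ∀ {p} → Prime p → fin 0ℤ <ᵛ val p a → ¬ p ∣ℤ D
  0<val⇒∤D p-prime 0<v p∣D = <ᵛ-asym (Equivalence.from (val<0⇔∣D p-prime) p∣D) 0<v

  0<val⇒∣N : ∀ {p} → Prime p → fin 0ℤ <ᵛ val p a → p ∣ℤ N
  0<val⇒∣N p-prime 0<v = val-÷>0⇒∣ p-prime a≐N/D (0<val⇒∤D p-prime 0<v) 0<v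

  val-orbit : ∀ {p} → Prime p → ¬ p ∣ℤ D → ∀ n → T n ≢ 0ℤ →
              val p (orbit a n ℚ.- a) ≡ val p a +ᵛ (+ νℤ p (T n))
  val-orbit {p} p-prime p∤D n Tn≢0 = by-cases (N ≟ 0ℤ)
    where
    by-cases : Dec (N ≡ 0ℤ) → val p (orbit a n ℚ.- a) ≡ val p a +ᵛ (+ νℤ p (T n))
    by-cases (yes N≡0) = trans (val-÷0 (orbit≐ n) (cong (_* T n) N≡0))
                               (sym (cong (_+ᵛ (+ νℤ p (T n))) (val-÷0 a≐N/D N≡0)))
    by-cases (no N≢0) = begin
      val p (orbit a n ℚ.- a)            ≡⟨ val-÷-∤den p-prime (orbit≐ n) (*≢0 N≢0 Tn≢0) (∤D⇒∤DE p-prime p∤D n) ⟩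
      fin (+ νℤ p (N * T n))             ≡⟨ cong (λ k → fin (+ k)) (νℤ-* p-prime N≢0 Tn≢0) ⟩
      fin (+ (νℤ p N ℕ.+ νℤ p (T n)))    ≡⟨ cong fin (pos-+ (νℤ p N) (νℤ p (T n))) ⟩
      fin (+ νℤ p N) +ᵛ (+ νℤ p (T n))   ≡⟨ cong (_+ᵛ (+ νℤ p (T n))) (val-÷-∤den p-prime a≐N/D N≢0 p∤D) ⟨
      val p a +ᵛ (+ νℤ p (T n))          ∎

  val₂-orbit≡0 : val 2 a ≡ fin 0ℤ → ∀ n → val 2 (orbit a n ℚ.- a) ≡ fin 0ℤ
  val₂-orbit≡0 v≡0 n = val-÷≡0 prime[2] (orbit≐ n) (∤-* prime[2] 2∤N 2∤T) (∤D⇒∤DE prime[2] 2∤D n)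
    where
    2∤D : ¬ 2 ∣ℤ D
    2∤D 2∣D = <ᵛ-irrefl (subst (_<ᵛ fin 0ℤ) v≡0 (Equivalence.from (val<0⇔∣D prime[2]) 2∣D))
    2∤N : ¬ 2 ∣ℤ N
    2∤N 2∣N = <ᵛ-irrefl (subst (fin 0ℤ <ᵛ_) v≡0 (val-÷>0 prime[2] a≐N/D 2∣N 2∤D))
    2∤T : ¬ 2 ∣ℤ T n
    2∤T = proj₁ (TS-∤ prime[2] 2∤N (inj₁ ∣-refl) n)

  val₂-orbit≡val₂+1 : fin (+ 1) ≤ᵛ val 2 a → ∀ n → 2 ≤ n → val 2 (orbit a n ℚ.- a) ≡ val 2 a +ᵛ (+ 1)
  val₂-orbit≡val₂+1 _   1             (s≤s ())
  val₂-orbit≡val₂+1 1≤v (suc (suc n)) _ = from-2-adic (T-2-adic (0<val⇒∣N prime[2] 0<v) 2∤D n)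
    where
    0<v : fin 0ℤ <ᵛ val 2 a
    0<v = 1≤ᵛ⇒0<ᵛ 1≤v
    2∤D : ¬ 2 ∣ℤ D
    2∤D = 0<val⇒∤D prime[2] 0<v
    from-2-adic : ∃[ W ] T (suc (suc n)) ≡ + 2 * W × ¬ 2 ∣ℤ W →
                  val 2 (orbit a (suc (suc n)) ℚ.- a) ≡ val 2 a +ᵛ (+ 1)
    from-2-adic (W , T≡2W , 2∤W) = begin
      val 2 (orbit a (suc (suc n)) ℚ.- a)        ≡⟨ val-orbit prime[2] 2∤D (suc (suc n)) T≢0 ⟩
      val 2 a +ᵛ (+ νℤ 2 (T (suc (suc n))))      ≡⟨ cong (λ k → val 2 a +ᵛ (+ k)) ν₂T≡1 ⟩
      val 2 a +ᵛ (+ 1)                           ∎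
      where
      W≢0 : W ≢ 0ℤ
      W≢0 = ∤⇒≢0 2∤W
      T≢0 : T (suc (suc n)) ≢ 0ℤ
      T≢0 T≡0 = *≢0 {+ 2} (λ ()) W≢0 (trans (sym T≡2W) T≡0)
      ν₂T≡1 : νℤ 2 (T (suc (suc n))) ≡ 1
      ν₂T≡1 = trans (cong (νℤ 2) T≡2W) (trans (νℤ-p* prime[2] W≢0) (cong suc (νℤ-∤ 2∤W)))

  val-orbit≡val : ∀ {p} → Prime p → fin 0ℤ <ᵛ val p a → p ≢ 2 →
                  ∀ n → 1 ≤ n → val p (orbit a n ℚ.- a) ≡ val p a
  val-orbit≡val {p} p-prime 0<v p≢2 (suc n) _ = begin
    val p (orbit a (suc n) ℚ.- a)    ≡⟨ val-orbit p-prime p∤D (suc n) (∤⇒≢0 p∤T) ⟩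
    val p a +ᵛ (+ νℤ p (T (suc n)))    ≡⟨ cong (λ k → val p a +ᵛ (+ k)) (νℤ-∤ p∤T) ⟩
    val p a +ᵛ 0ℤ                    ≡⟨ +ᵛ-identityʳ (val p a) ⟩
    val p a                          ∎
    where
    p∤D : ¬ p ∣ℤ D
    p∤D = 0<val⇒∤D p-prime 0<v
    p∤T : ¬ p ∣ℤ T (suc n)
    p∤T = T-∤ p-prime (0<val⇒∣N p-prime 0<v) (p≢2 ∘ ∣2⇒≡2 p-prime) p∤D n

  0<val-orbit⇒∤D : ∀ {p} → Prime p → ∀ n → fin 0ℤ <ᵛ val p (orbit a n ℚ.- a) → ¬ p ∣ℤ D
  0<val-orbit⇒∤D p-prime n 0<v p∣D = <ᵛ-asym (Equivalence.from (val-orbit<0⇔∣D p-prime n) p∣D) 0<v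

  0<val-orbit-twice⇒0<val : ∀ {p} → Prime p → ∀ {m n} → m ≢ n →
    fin 0ℤ <ᵛ val p (orbit a m ℚ.- a) → fin 0ℤ <ᵛ val p (orbit a n ℚ.- a) → fin 0ℤ <ᵛ val p a
  0<val-orbit-twice⇒0<val {p} p-prime {m} {n} m≢n 0<vₘ 0<vₙ with + p ∣? N
  ... | yes p∣N = val-÷>0 p-prime a≐N/D p∣N (0<val-orbit⇒∤D p-prime m 0<vₘ)
  ... | no p∤N = ⊥-elim (m≢n (∣T-unique p-prime p∤N p∤D (∣T m 0<vₘ) (∣T n 0<vₙ)))
    where
    p∤D : ¬ p ∣ℤ D
    p∤D = 0<val-orbit⇒∤D p-prime m 0<vₘ
    ∣T : ∀ k → fin 0ℤ <ᵛ val p (orbit a k ℚ.- a) → p ∣ℤ T k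
    ∣T k 0<v = [ ⊥-elim ∘ p∤N , id ]′
      (euclidsLemmaℤ N (T k) p-prime (val-÷>0⇒∣ p-prime (orbit≐ k) (∤D⇒∤DE p-prime p∤D k) 0<v))

open import Data.Nat using (ℕ; _≤_)
open import Data.Nat.Properties using (≤-refl)
open import Data.Integer using (+_)
open import Data.Rational using (_-_)
open import Data.Nat.Primality using (Prime)
open import Data.Product using (_×_; _,_; ∃-syntax)
open import Function.Bundles using (_⇔_; mk⇔; Equivalence)
open import Relation.Binary.PropositionalEquality using (_≡_; _≢_)
open OrbitValuation

proposition3p2 : (a : ℚ) (p : ℕ) → Prime p →
    ((val p a <ᵛ fin (+ 0)) ⇔ (∃[ n ] (1 ≤ n × val p (orbit a n - a) <ᵛ fin (+ 0))))
    × ((val p a <ᵛ fin (+ 0)) ⇔ (∀ n → 1 ≤ n → val p (orbit a n - a) <ᵛ fin (+ 0)))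
    × (val 2 a ≡ fin (+ 0) → ∀ n → val 2 (orbit a n - a) ≡ fin (+ 0))
    × (fin (+ 1) ≤ᵛ val 2 a → ∀ n → 2 ≤ n → val 2 (orbit a n - a) ≡ val 2 a +ᵛ (+ 1))
    × (fin (+ 0) <ᵛ val p a → p ≢ 2 → ∀ n → 1 ≤ n → val p (orbit a n - a) ≡ val p a)
    × (∀ m n → 1 ≤ m → 1 ≤ n → m ≢ n →
         fin (+ 0) <ᵛ val p (orbit a m - a) → fin (+ 0) <ᵛ val p (orbit a n - a) →
         fin (+ 0) <ᵛ val p a)
-- In parts (1) and (5) the hypotheses 1 ≤ n and 1 ≤ m are unused: these parts hold for index 0 as well.
proposition3p2 a p p-prime =
    mk⇔ (λ a<0 → 1 , ≤-refl , to (negative 1) a<0) (λ (n , _ , orbit<0) → from (negative n) orbit<0)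
  , mk⇔ (λ a<0 n _ → to (negative n) a<0) (λ orbit<0 → from (negative 1) (orbit<0 1 ≤-refl))
  , val₂-orbit≡0 a
  , val₂-orbit≡val₂+1 a
  , val-orbit≡val a p-prime
  , λ m n _ _ m≢n → 0<val-orbit-twice⇒0<val a p-prime m≢n
  where
  open Equivalence
  negative : ∀ n → val p a <ᵛ fin (+ 0) ⇔ val p (orbit a n - a) <ᵛ fin (+ 0)
  negative = val<0⇔val-orbit<0 a p-prime
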